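{- Let $M_0$ be a live marking of a net $N=(P,T,F)$. Then there is an optimal marking $M$ reachable from $M_0$.
   Context: A net $N=(P,T,F)$ has finite disjoint $P,T$ and $F:(P\times T)\cup(T\times P)\to\mathbb{N}$. Markings $M:P\to\mathbb{N}$; $t$ enabled at $M$ if $M(p)\ge F(p,t)$ for all $p$; firing gives $M'(p)=M(p)-F(p,t)+F(t,p)$. A transition is dead at $M$ if enabled at no marking reachable from $M$, live at $M$ if not dead at any marking reachable from $M$; $M$ is live if all transitions are live at $M$. The carrier of $M$ is $\mathrm{carrier}(M)=\{p\mid M(p)\ge1\}$. $M$ is carrier-maximal if $|\mathrm{carrier}(M')|\le|\mathrm{carrier}(M)|$ for every $M'$ reachable from $M$. A transition sequence is full if every $t\in T$ occurs in it. $M$ is self-coverable if there is an execution $M\xrightarrow{\sigma}M'$ with $\sigma$ full and $M\le M'$ (componentwise). $M$ is optimal if it is carrier-maximal and self-coverable. -}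

module Defs where

open import Data.Nat using (ℕ; _≤_; _∸_; _+_)
open import Data.Nat.Properties using (_≤?_)
open import Data.Fin using (Fin)
open import Data.Fin.Subset using (Subset; ∣_∣)
open import Data.Vec using (tabulate)
open import Data.Bool using (Bool; true; false)
open import Data.List using (List; []; _∷_)
open import Data.List.Membership.Propositional using (_∈_)
open import Data.Product using (Σ; ∃; _×_; _,_)
open import Relation.Nullary using (¬_)
open import Relation.Nullary.Decidable using (⌊_⌋)
open import Relation.Binary.PropositionalEquality using (_≡_)

-- A net N = (P, T, F) with P = Fin np, T = Fin nt (finite, disjoint as types);
-- F is split into the two parts F(p,t) (pre) and F(t,p) (post).
record Net : Set where
  field
    np   : ℕ
    nt   : ℕ
    pre  : Fin np → Fin nt → ℕ
    post : Fin nt → Fin np → ℕ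
open Net public

Marking : Net → Set
Marking N = Fin (np N) → ℕ

Transition : Net → Set
Transition N = Fin (nt N)

_≤ᴹ_ : {N : Net} → Marking N → Marking N → Set
M ≤ᴹ M' = ∀ p → M p ≤ M' p

Enabled : (N : Net) → Transition N → Marking N → Set
Enabled N t M = ∀ p → pre N p t ≤ M p

-- marking after firing t (meaningful when t is enabled)
fire : (N : Net) → Transition N → Marking N → Marking N
fire N t M p = (M p ∸ pre N p t) + post N t p

data Execution (N : Net) : Marking N → List (Transition N) → Marking N → Set where
  done : ∀ {M} → Execution N M [] M
  step : ∀ {M M' σ t} → Enabled N t M → Execution N (fire N t M) σ M' →
         Execution N M (t ∷ σ) M'

Reachable : (N : Net) → Marking N → Marking N → Set
Reachable N M M' = Σ (List (Transition N)) λ σ → Execution N M σ M'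

Dead : (N : Net) → Transition N → Marking N → Set
Dead N t M = ∀ M' → Reachable N M M' → ¬ Enabled N t M'

LiveAt : (N : Net) → Transition N → Marking N → Set
LiveAt N t M = ∀ M' → Reachable N M M' → ¬ Dead N t M'

Live : (N : Net) → Marking N → Set
Live N M = ∀ t → LiveAt N t M

carrier : (N : Net) → Marking N → Subset (np N)
carrier N M = tabulate λ p → ⌊ 1 ≤? M p ⌋

CarrierMaximal : (N : Net) → Marking N → Set
CarrierMaximal N M = ∀ M' → Reachable N M M' → ∣ carrier N M' ∣ ≤ ∣ carrier N M ∣

Full : (N : Net) → List (Transition N) → Set
Full N σ = ∀ (t : Transition N) → t ∈ σ

SelfCoverable : (N : Net) → Marking N → Set
SelfCoverable N M = ∃ λ σ → ∃ λ M' → Execution N M σ M' × Full N σ × (_≤ᴹ_ {N} M M')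

Optimal : (N : Net) → Marking N → Set
Optimal N M = CarrierMaximal N M × SelfCoverable N M

-- Dickson's lemma, in the inductive form of bars, terminates two searches. Saturating a
-- finite basis of an upward-closed set backwards makes coverability decidable; this is what
-- turns liveness into actual firing sequences and yields a reachable marking of maximal
-- carrier size. From a carrier-maximal X, fire a full sequence and move on to a
-- carrier-maximal X' reachable from its end. If the carrier shrinks, restart from X';
-- otherwise the markings visited at this carrier size are carrier-maximal and each reaches
-- every later one by a full sequence. This sequence cannot stay bad, so some earlier
-- marking is covered by a later one, and that marking is optimal.
module Submission where

open import Defs
open import Data.Bool using (if_then_else_)
open import Data.Empty using (⊥-elim)
open import Data.Fin using (Fin; zero; suc; punchIn; punchOut; _≟_)
open import Data.Fin.Properties using (all?; ¬∀⟶∃¬; punchIn-punchOut)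
open import Data.Fin.Subset using (Subset; ∣_∣)
import Data.Fin.Subset as Sub
open import Data.Fin.Subset.Properties using (anySubset?; p⊆q⇒∣p∣≤∣q∣; ∣p∣≤n)
open import Data.List using (List; []; _∷_; _++_; map; allFin)
open import Data.List.Membership.Propositional using (_∈_)
open import Data.List.Membership.Propositional.Properties using (∈-++⁺ˡ; ∈-++⁺ʳ; ∈-allFin)
open import Data.List.Relation.Unary.All as All using (All; []; _∷_; lookupAny)
open import Data.List.Relation.Unary.All.Properties using (¬Any⇒All¬; ¬All⇒Any¬; map⁺)
open import Data.List.Relation.Unary.Any as Any using (Any; here; there; any?)
open import Data.Nat using (ℕ; zero; suc; _+_; _∸_; _≤_; _<_; z≤n)
open import Data.Nat.Induction using (<-rec)
open import Data.Nat.Properties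
  using (≤-refl; ≤-trans; ≤-reflexive; _≤?_; ≰⇒>; ≮⇒≥; ≤⇒≯; <-≤-trans; +-comm; +-monoˡ-≤; ∸-monoˡ-≤;
         m+n∸n≡m; m≤n+m∸n; m+n≤o⇒n≤o; m+n≤o⇒m≤o∸n; m≤o∸n⇒m+n≤o; m<1+n⇒m<n∨m≡n; m≤n⇒m<n∨m≡n;
         module ≤-Reasoning)
open import Data.Product using (Σ; ∃; ∃₂; _×_; _,_)
open import Data.Sum using (inj₁; inj₂)
open import Data.Unit using (tt)
open import Data.Vec using (lookup)
open import Data.Vec.Functional using (Vector)
open import Data.Vec.Functional.Relation.Binary.Pointwise using (Pointwise)
import Data.Vec.Functional.Relation.Binary.Pointwise.Properties as Pointwise
open import Data.Vec.Properties using (lookup∘tabulate; []=⇒lookup; lookup⇒[]=)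
open import Function using (_∘_)
open import Level using (0ℓ)
open import Relation.Binary using (Rel)
open import Relation.Binary.PropositionalEquality using (_≡_; refl; sym; trans; subst)
open import Relation.Nullary using (¬_; Dec; yes; no)
open import Relation.Nullary.Decidable using (⌊_⌋; isYes≗does; map′; dec-true; _×-dec_)
open import Relation.Unary using (Pred; U; ∅; _∪_; _∩_; _⊆_; ⋃)

module _ {A : Set} (R : Rel A 0ℓ) where

  Fresh : List A → Pred A 0ℓ
  Fresh xs a = All (λ x → ¬ R x a) xs

  -- Bar R P xs: every bad sequence of P-elements extending the reversed list xs is finite.
  data Bar (P : Pred A 0ℓ) (xs : List A) : Set where
    bar : (∀ a → P a → Fresh xs a → Bar P (a ∷ xs)) → Bar P xs

module _ {A : Set} {R : Rel A 0ℓ} where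

  bar-∅ : ∀ {xs} → Bar R ∅ xs
  bar-∅ = bar λ _ ()

  bar-mono : ∀ {P Q xs} → P ⊆ Q → Bar R Q xs → Bar R P xs
  bar-mono P⊆Q (bar w) = bar λ a pa fresh → bar-mono P⊆Q (w a (P⊆Q pa) fresh)

  bar-restrict : ∀ {P Q xs ys} → Bar R Q ys → Fresh R xs ⊆ Fresh R ys →
                 P ∩ Fresh R xs ⊆ Q → Bar R P xs
  bar-restrict {P} {xs = xs} (bar w) fresh⊆ P⊆Q = bar extend
    where
    extend : ∀ a → P a → Fresh R xs a → Bar R P (a ∷ xs)
    extend a pa fresh = bar-restrict (w a (P⊆Q (pa , fresh)) (fresh⊆ fresh))
      (λ { (¬ra ∷ fresh′) → ¬ra ∷ fresh⊆ fresh′ }) (λ (p , fresh′) → P⊆Q (p , All.tail fresh′))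

  -- xs₁ and xs₂ are the elements of xs of colour 1 and 2; a new element only has to be
  -- fresh with respect to those of its own colour, so one of the two bars descends.
  bar-union : ∀ {P P₁ P₂ xs xs₁ xs₂} → Bar R P₁ xs₁ → Bar R P₂ xs₂ →
              Fresh R xs ⊆ Fresh R xs₁ → Fresh R xs ⊆ Fresh R xs₂ →
              P ∩ Fresh R xs ⊆ P₁ ∪ P₂ → Bar R P xs
  bar-union {P} {P₁} {P₂} {xs} (bar w₁) (bar w₂) fresh⊆₁ fresh⊆₂ colour = bar extend
    where
    colour′ : ∀ {a} → P ∩ Fresh R (a ∷ xs) ⊆ P₁ ∪ P₂
    colour′ (p , fresh) = colour (p , All.tail fresh)
    extend : ∀ a → P a → Fresh R xs a → Bar R P (a ∷ xs)
    extend a pa fresh with colour (pa , fresh)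
    ... | inj₁ p₁ = bar-union (w₁ a p₁ (fresh⊆₁ fresh)) (bar w₂)
      (λ { (¬ra ∷ fresh′) → ¬ra ∷ fresh⊆₁ fresh′ }) (fresh⊆₂ ∘ All.tail) colour′
    ... | inj₂ p₂ = bar-union (bar w₁) (w₂ a p₂ (fresh⊆₂ fresh))
      (fresh⊆₁ ∘ All.tail) (λ { (¬ra ∷ fresh′) → ¬ra ∷ fresh⊆₂ fresh′ }) colour′

  bar-∪ : ∀ {P Q} → Bar R P [] → Bar R Q [] → Bar R (P ∪ Q) []
  bar-∪ barP barQ = bar-union barP barQ (λ _ → []) (λ _ → []) (λ (p , _) → p)

  bar-⋃ : ∀ m {Q : Fin m → Pred A 0ℓ} → (∀ i → Bar R (Q i) []) → Bar R (⋃ (Fin m) Q) []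
  bar-⋃ zero    bars = bar-mono (λ { (() , _) }) bar-∅
  bar-⋃ (suc m) {Q} bars = bar-mono split (bar-∪ (bars zero) (bar-⋃ m (bars ∘ suc)))
    where
    split : ⋃ (Fin (suc m)) Q ⊆ Q zero ∪ ⋃ (Fin m) (Q ∘ suc)
    split (zero  , q) = inj₁ q
    split (suc i , q) = inj₂ (i , q)

bar-comap : ∀ {A B : Set} {R : Rel A 0ℓ} {S : Rel B 0ℓ} {P : Pred A 0ℓ} (f : A → B) →
            (∀ {a b} → P a → P b → S (f a) (f b) → R a b) →
            ∀ {xs} → All P xs → Bar S U (map f xs) → Bar R P xs
bar-comap {R = R} {S} {P} f reflects {xs} ps (bar w) = bar extend
  where
  extend : ∀ a → P a → Fresh R xs a → Bar R P (a ∷ xs)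
  extend a pa fresh = bar-comap f reflects (pa ∷ ps) (w (f a) tt (map⁺ (All.zipWith
    (λ (px , ¬rxa) sfxfa → ¬rxa (reflects px pa sfxfa)) (ps , fresh))))

infix 4 _≤ᵖ_ _≤ᵖ?_

_≤ᵖ_ : ∀ {n} → Vector ℕ n → Vector ℕ n → Set
_≤ᵖ_ = Pointwise _≤_

≤ᵖ-refl : ∀ {n} {x : Vector ℕ n} → x ≤ᵖ x
≤ᵖ-refl = Pointwise.refl {R = _≤_} ≤-refl

≤ᵖ-trans : ∀ {n} {x y z : Vector ℕ n} → x ≤ᵖ y → y ≤ᵖ z → x ≤ᵖ z
≤ᵖ-trans = Pointwise.trans {R = _≤_} ≤-trans

_≤ᵖ?_ : ∀ {n} (x y : Vector ℕ n) → Dec (x ≤ᵖ y)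
_≤ᵖ?_ = Pointwise.decidable _≤?_

dickson : ∀ n → Bar (_≤ᵖ_ {n}) U []
dickson zero    = bar λ a _ _ → bar λ { b _ (a≰b ∷ []) → ⊥-elim (a≰b λ ()) }
dickson (suc n) = bar λ v _ _ →
  bar-restrict (bar-⋃ (suc n) λ i → below i (v i)) (λ _ → []) (some-coordinate-below v)
  where
  slab : ∀ i c → Bar _≤ᵖ_ (λ a → a i ≡ c) []
  slab i c = bar-comap (λ a → a ∘ punchIn i) reflects [] (dickson n)
    where
    reflects : ∀ {a b} → a i ≡ c → b i ≡ c → (a ∘ punchIn i) ≤ᵖ (b ∘ punchIn i) → a ≤ᵖ b
    reflects {a} {b} refl bi≡ai a≤b p with i ≟ p
    ... | yes refl = ≤-reflexive (sym bi≡ai)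
    ... | no  i≢p  = subst (λ q → a q ≤ b q) (punchIn-punchOut i≢p) (a≤b (punchOut i≢p))

  below : ∀ i k → Bar _≤ᵖ_ (λ a → a i < k) []
  below i zero    = bar-mono (λ ()) bar-∅
  below i (suc k) = bar-mono m<1+n⇒m<n∨m≡n (bar-∪ (below i k) (slab i k))

  some-coordinate-below : ∀ v → U ∩ Fresh _≤ᵖ_ (v ∷ []) ⊆ ⋃ (Fin (suc n)) (λ i a → a i < v i)
  some-coordinate-below v {a} (_ , v≰a ∷ []) with ¬∀⟶∃¬ _ _ (λ p → v p ≤? a p) v≰a
  ... | i , vi≰ai = i , ≰⇒> vi≰ai

lastTrue : ∀ {P : Pred ℕ 0ℓ} → (∀ k → Dec (P k)) → P 0 → ∀ n → ¬ P n → ∃ λ k → P k × ¬ P (suc k)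
lastTrue P? p0 zero    ¬pn = ⊥-elim (¬pn p0)
lastTrue P? p0 (suc n) ¬pn with P? n
... | yes pn = n , pn , ¬pn
... | no ¬pn′ = lastTrue P? p0 n ¬pn′

module _ (N : Net) where

  execution-++ : ∀ {X Y Z σ τ} → Execution N X σ Y → Execution N Y τ Z → Execution N X (σ ++ τ) Z
  execution-++ done         Y→Z = Y→Z
  execution-++ (step en ex) Y→Z = step en (execution-++ ex Y→Z)

  reachable-refl : ∀ {X} → Reachable N X X
  reachable-refl = [] , done

  reachable-trans : ∀ {X Y Z} → Reachable N X Y → Reachable N Y Z → Reachable N X Z
  reachable-trans (σ , X→Y) (τ , Y→Z) = σ ++ τ , execution-++ X→Y Y→Z

  live-reachable : ∀ {X Y} → Live N X → Reachable N X Y → Live N Y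
  live-reachable live X→Y t Z Y→Z = live t Z (reachable-trans X→Y Y→Z)

  FullRun : Marking N → Marking N → Set
  FullRun X Y = ∃ λ σ → Execution N X σ Y × Full N σ

  fullRun⇒reachable : ∀ {X Y} → FullRun X Y → Reachable N X Y
  fullRun⇒reachable (σ , X→Y , _) = σ , X→Y

  fullRun-reachable : ∀ {X Y Z} → FullRun X Y → Reachable N Y Z → FullRun X Z
  fullRun-reachable (σ , X→Y , full) (τ , Y→Z) = σ ++ τ , execution-++ X→Y Y→Z , ∈-++⁺ˡ ∘ full

  Coverable : Marking N → Marking N → Set
  Coverable X m = ∃ λ Y → Reachable N X Y × m ≤ᵖ Y

  -- The least marking from which firing t yields a marking above m.
  predBasis : Transition N → Marking N → Marking N
  predBasis t m p = (m p ∸ post N t p) + pre N p t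

  predBasis-≤⇒enabled : ∀ {t m X} → predBasis t m ≤ᵖ X → Enabled N t X
  predBasis-≤⇒enabled {t} {m} le p = m+n≤o⇒n≤o (m p ∸ post N t p) (le p)

  predBasis-≤⇒≤fire : ∀ {t m X} → predBasis t m ≤ᵖ X → m ≤ᵖ fire N t X
  predBasis-≤⇒≤fire {t} {m} {X} le p = begin
    m p                               ≤⟨ m≤n+m∸n (m p) (post N t p) ⟩
    post N t p + (m p ∸ post N t p)   ≡⟨ +-comm (post N t p) _ ⟩
    (m p ∸ post N t p) + post N t p   ≤⟨ +-monoˡ-≤ (post N t p) (m+n≤o⇒m≤o∸n _ (le p)) ⟩
    (X p ∸ pre N p t) + post N t p    ∎
    where open ≤-Reasoning

  ≤fire⇒predBasis-≤ : ∀ {t m X} → Enabled N t X → m ≤ᵖ fire N t X → predBasis t m ≤ᵖ X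
  ≤fire⇒predBasis-≤ {t} {m} {X} en le p = m≤o∸n⇒m+n≤o _ (en p) (begin
    m p ∸ post N t p                                    ≤⟨ ∸-monoˡ-≤ (post N t p) (le p) ⟩
    (X p ∸ pre N p t) + post N t p ∸ post N t p         ≡⟨ m+n∸n≡m _ (post N t p) ⟩
    X p ∸ pre N p t                                     ∎)
    where open ≤-Reasoning

  AboveCovers : Marking N → Marking N → Set
  AboveCovers m b = ∀ {X} → b ≤ᵖ X → Coverable X m

  aboveCovers-predBasis : ∀ {m b} t → AboveCovers m b → AboveCovers m (predBasis t b)
  aboveCovers-predBasis t above le with above (predBasis-≤⇒≤fire le)
  ... | Y , (σ , run) , m≤Y = Y , (t ∷ σ , step (predBasis-≤⇒enabled le) run) , m≤Y

  Dominated : List (Marking N) → Marking N → Set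
  Dominated B X = Any (_≤ᵖ X) B

  dominated? : ∀ B X → Dec (Dominated B X)
  dominated? B X = any? (_≤ᵖ? X) B

  dominated-mono : ∀ {B X Y} → X ≤ᵖ Y → Dominated B X → Dominated B Y
  dominated-mono X≤Y = Any.map (λ b≤X → ≤ᵖ-trans b≤X X≤Y)

  Closed : List (Marking N) → Set
  Closed B = ∀ t → All (λ b → Dominated B (predBasis t b)) B

  closed? : ∀ B → Dec (Closed B)
  closed? B = all? λ t → All.all? (λ b → dominated? B (predBasis t b)) B

  dominated-backward : ∀ {B X σ Y} → Closed B → Execution N X σ Y → Dominated B Y → Dominated B X
  dominated-backward closed done dom = dom
  dominated-backward {B} closed (step {t = t} en run) dom
    with lookupAny (closed t) (dominated-backward closed run dom)
  ... | dom′ , b≤fire = dominated-mono (≤fire⇒predBasis-≤ en b≤fire) dom′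

  record CoverBasis (m : Marking N) : Set where
    field
      basis   : List (Marking N)
      sound   : All (AboveCovers m) basis
      closed  : Closed basis
      covers  : Dominated basis m

  saturate : ∀ {m} B → Bar _≤ᵖ_ U B → All (AboveCovers m) B → Dominated B m → CoverBasis m
  saturate B (bar w) sound covers with closed? B
  ... | yes closed = record { basis = B ; sound = sound ; closed = closed ; covers = covers }
  ... | no ¬closed with ¬∀⟶∃¬ _ _ (λ t → All.all? (λ b → dominated? B (predBasis t b)) B) ¬closed
  ...   | t , ¬all with ¬All⇒Any¬ (λ b → dominated? B (predBasis t b)) B ¬all
  ...     | missing with lookupAny sound missing
  ...       | above , undominated = saturate (predBasis t _ ∷ B) (w _ tt (¬Any⇒All¬ B undominated))
                (aboveCovers-predBasis t above ∷ sound) (there covers)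

  coverBasis : ∀ m → CoverBasis m
  coverBasis m with dickson (np N)
  ... | bar w = saturate (m ∷ []) (w m tt []) ((λ m≤X → _ , reachable-refl , m≤X) ∷ []) (here ≤ᵖ-refl)

  coverable? : ∀ X m → Dec (Coverable X m)
  coverable? X m = map′ sound-dominated complete (dominated? basis X)
    where
    open CoverBasis (coverBasis m)
    sound-dominated : Dominated basis X → Coverable X m
    sound-dominated dom = let above , b≤X = lookupAny sound dom in above b≤X
    complete : Coverable X m → Dominated basis X
    complete (Y , (σ , run) , m≤Y) = dominated-backward closed run (dominated-mono m≤Y covers)

  enabled-reachable : ∀ {X} → Live N X → ∀ t → ∃ λ Y → Reachable N X Y × Enabled N t Y
  enabled-reachable {X} live t with coverable? X (λ p → pre N p t)
  ... | yes coverable = coverable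
  ... | no ¬coverable = ⊥-elim (live t X reachable-refl λ Y X→Y en → ¬coverable (Y , X→Y , en))

  run-through : ∀ ts {X} → Live N X → ∃₂ λ σ Y → Execution N X σ Y × All (_∈ σ) ts
  run-through []       live = [] , _ , done , []
  run-through (t ∷ ts) live with enabled-reachable live t
  ... | Y , (σ , X→Y) , en
    with run-through ts (live-reachable live (σ ++ t ∷ [] , execution-++ X→Y (step en done)))
  ...   | ρ , Z , Y′→Z , ts∈ρ = σ ++ t ∷ ρ , Z , execution-++ X→Y (step en Y′→Z) ,
          ∈-++⁺ʳ σ (here refl) ∷ All.map (∈-++⁺ʳ σ ∘ there) ts∈ρ

  fullRun : ∀ {X} → Live N X → ∃ (FullRun X)
  fullRun live with run-through (allFin (nt N)) live
  ... | σ , Y , X→Y , all∈σ = Y , σ , X→Y , λ t → All.lookup all∈σ (∈-allFin t)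

  indicator : Subset (np N) → Marking N
  indicator S p = if lookup S p then 1 else 0

  indicator-carrier : ∀ M → indicator (carrier N M) ≤ᵖ M
  indicator-carrier M p rewrite lookup∘tabulate (λ q → ⌊ 1 ≤? M q ⌋) p with 1 ≤? M p
  ... | yes 1≤Mp = 1≤Mp
  ... | no  _    = z≤n

  indicator≤⇒⊆carrier : ∀ {S M} → indicator S ≤ᵖ M → S Sub.⊆ carrier N M
  indicator≤⇒⊆carrier {S} {M} S≤M {p} p∈S = lookup⇒[]= p (carrier N M)
    (trans (lookup∘tabulate _ p) (trans (isYes≗does (1 ≤? M p)) (dec-true (1 ≤? M p) one≤Mp)))
    where
    one≤Mp : 1 ≤ M p
    one≤Mp with S≤M p
    ... | le rewrite []=⇒lookup p∈S = le

  ReachesCarrier : Marking N → ℕ → Set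
  ReachesCarrier L k = ∃ λ Y → Reachable N L Y × k ≤ ∣ carrier N Y ∣

  reachesCarrier? : ∀ L k → Dec (ReachesCarrier L k)
  reachesCarrier? L k = map′ from to
    (anySubset? {P = λ S → k ≤ ∣ S ∣ × Coverable L (indicator S)}
      λ S → (k ≤? ∣ S ∣) ×-dec coverable? L (indicator S))
    where
    from : (∃ λ S → k ≤ ∣ S ∣ × Coverable L (indicator S)) → ReachesCarrier L k
    from (S , k≤∣S∣ , Y , L→Y , S≤Y) =
      Y , L→Y , ≤-trans k≤∣S∣ (p⊆q⇒∣p∣≤∣q∣ (indicator≤⇒⊆carrier {S} S≤Y))
    to : ReachesCarrier L k → ∃ λ S → k ≤ ∣ S ∣ × Coverable L (indicator S)
    to (Y , L→Y , k≤) = carrier N Y , k≤ , Y , L→Y , indicator-carrier Y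

module _ (N : Net) where

  carrierMaximal-reachable : ∀ L → ∃ λ M → Reachable N L M × CarrierMaximal N M
  carrierMaximal-reachable L
    with lastTrue (reachesCarrier? N L) (L , reachable-refl N , z≤n) (suc (np N))
           (λ (Y , _ , big) → ≤⇒≯ (∣p∣≤n (carrier N Y)) big)
  ... | k , (M , L→M , k≤M) , ¬above = M , L→M , λ M′ M→M′ →
    ≤-trans (≮⇒≥ λ k<M′ → ¬above (M′ , reachable-trans N L→M M→M′ , k<M′)) k≤M

  next-carrierMaximal : ∀ {X} → Live N X → ∃ λ X′ → FullRun N X X′ × CarrierMaximal N X′
  next-carrierMaximal live with fullRun N live
  ... | W , X⇒W with carrierMaximal-reachable W
  ...   | X′ , W→X′ , maxX′ = X′ , fullRun-reachable N X⇒W W→X′ , maxX′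

module _ (N : Net) (M₀ : Marking N) (live : Live N M₀) where

  OptimalReachable : Set
  OptimalReachable = ∃ λ M → Reachable N M₀ M × Optimal N M

  Candidate : Marking N → Marking N → Set
  Candidate X b = Reachable N M₀ b × CarrierMaximal N b × FullRun N b X

  candidate-reachable : ∀ {X X′ b} → Reachable N X X′ → Candidate X b → Candidate X′ b
  candidate-reachable X→X′ (M₀→b , maxb , b⇒X) = M₀→b , maxb , fullRun-reachable N b⇒X X→X′

  StartingAt : ℕ → Set
  StartingAt k = ∀ X → Reachable N M₀ X → CarrierMaximal N X → ∣ carrier N X ∣ ≡ k → OptimalReachable

  search : ∀ {k} → (∀ {j} → j < k → StartingAt j) →
           ∀ X → Reachable N M₀ X → CarrierMaximal N X → ∣ carrier N X ∣ ≡ k →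
           ∀ B → Bar _≤ᵖ_ U B → All (Candidate X) B → OptimalReachable
  search restart X M₀→X maxX size B (bar w) candidates with dominated? N B X
  ... | yes dom with lookupAny candidates dom
  ...   | (M₀→b , maxb , σ , b→X , full) , b≤X = _ , M₀→b , maxb , σ , X , b→X , full , b≤X
  search restart X M₀→X maxX size B (bar w) candidates | no ¬dom
    with next-carrierMaximal N (live-reachable N live M₀→X)
  ... | X′ , X⇒X′ , maxX′ with fullRun⇒reachable N X⇒X′
  ...   | X→X′ with m≤n⇒m<n∨m≡n (maxX X′ X→X′)
  ...     | inj₁ smaller = restart (<-≤-trans smaller (≤-reflexive size))
                X′ (reachable-trans N M₀→X X→X′) maxX′ refl
  ...     | inj₂ same = search restart
                X′ (reachable-trans N M₀→X X→X′) maxX′ (trans same size)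
                (X ∷ B) (w X tt (¬Any⇒All¬ B ¬dom))
                ((M₀→X , maxX , X⇒X′) ∷ All.map (candidate-reachable X→X′) candidates)

  startingAt : ∀ k → StartingAt k
  startingAt = <-rec StartingAt λ k restart X M₀→X maxX size →
    search restart X M₀→X maxX size [] (dickson (np N)) []

proposition5p1 : (N : Net) (M₀ : Marking N) → Live N M₀ →
    Σ (Marking N) λ M → Reachable N M₀ M × Optimal N M
proposition5p1 N M₀ live with carrierMaximal-reachable N M₀
... | X , M₀→X , maxX = startingAt N M₀ live _ X M₀→X maxX refl
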